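{- Let $G=(V,E)$ be a correlation clustering instance, $OPT$ an optimal clustering of $G$, and $C_{OPT}$ the number of mistakes made by $OPT$. Then \textsc{QueryPivot} (described in the context), run with the oracle corresponding to $OPT$, makes at most $2C_{OPT}$ queries to the oracle.
   Context: Correlation clustering: the input is a complete graph $G=(V,E)$ in which every edge is labeled $+$ or $-$. A clustering is a partition of $V$; it makes a mistake on a $+$ edge whose endpoints are in different clusters and on a $-$ edge whose endpoints are in the same cluster. An optimal clustering minimizes the number of mistakes. The oracle corresponding to $OPT$ answers a query on $\{u,v\}$ by saying whether $OPT$ makes a mistake on $\{u,v\}$. A $(+,+,-)$ triangle is a set of three vertices two of whose edges are $+$ and one is $-$. \textsc{QueryPivot}$(V)$: if $V=\emptyset$ return the empty clustering. Otherwise pick an arbitrary pivot $u\in V$; let $T$ be the set of all $(+,+,-)$ triangles within $V$ containing $u$; initialize $Queried[x]=0$, $Mistake[x]=0$ for all $x$. For each triangle $(u,v,w)\in T$: if $Mistake[v]=1$ or $Mistake[w]=1$, skip; else if $Queried[v]=Queried[w]=1$, skip; otherwise, if $Queried[v]=0$, set $Queried[v]=1$, query $\{u,v\}$ and set $Mistake[v]=1$ if $OPT$ errs on it; then if $Queried[w]=0$ and $Mistake[v]=0$, set $Queried[w]=1$, query $\{u,w\}$ and set $Mistake[w]=1$ if $OPT$ errs on it. Then let $C$ consist of $u$ and every $x\in V\setminus\{u\}$ with either ($\{u,x\}$ is $+$ and $Mistake[x]=0$) or ($\{u,x\}$ is $-$ and $Mistake[x]=1$). Return $\{C\}\cup$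 \textsc{QueryPivot}$(V\setminus C)$. -}

module Defs where

open import Data.Nat using (ℕ; zero; suc; _+_; _*_; _<ᵇ_; _≡ᵇ_; _≤_)
open import Data.Bool using (Bool; true; false; if_then_else_; _∧_; _∨_; not)
open import Data.Fin using (Fin; toℕ)
open import Data.Fin.Properties using () renaming (_≟_ to _≟F_)
open import Data.List using (List; []; _∷_; length; filter)
open import Data.Nat.ListAction using (sum)
open import Data.List.Membership.Propositional using (_∈_)
open import Data.Product using (_×_; _,_; proj₁; proj₂)
open import Relation.Nullary.Decidable using (⌊_⌋)
open import Relation.Binary.PropositionalEquality using (_≡_; _≢_)
open import Data.List using (allFin) renaming (map to lmap)

-- Vertices of the instance are Fin n.
-- A labelling: sgn u v = true means {u,v} is a + edge, false means − edge.
Labelling : ℕ → Set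
Labelling n = Fin n → Fin n → Bool

-- A clustering (partition of Fin n) given by cluster labels: x, y are in the
-- same cluster iff cl x ≡ cl y.  Every partition of Fin n arises this way.
Clustering : ℕ → Set
Clustering n = Fin n → ℕ

eqF : ∀ {n} → Fin n → Fin n → Bool
eqF x y = ⌊ x ≟F y ⌋

mistakeOn : ∀ {n} → Labelling n → Clustering n → Fin n → Fin n → Bool
mistakeOn sgn cl u v =
  if sgn u v then not (cl u ≡ᵇ cl v) else (cl u ≡ᵇ cl v)

mistakes : ∀ {n} → Labelling n → Clustering n → ℕ
mistakes {n} sgn cl =
  sum (lmap (λ i → sum (lmap (λ j →
         if (toℕ i <ᵇ toℕ j) ∧ mistakeOn sgn cl i j then 1 else 0)
       (allFin n))) (allFin n))

Optimal : ∀ {n} → Labelling n → Clustering n → Set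
Optimal sgn opt = ∀ cl → mistakes sgn opt ≤ mistakes sgn cl

SymmetricL : ∀ {n} → Labelling n → Set
SymmetricL {n} sgn = ∀ (u v : Fin n) → sgn u v ≡ sgn v u

Oracle : ℕ → Set
Oracle n = Fin n → Fin n → Bool

oracleOf : ∀ {n} → Labelling n → Clustering n → Oracle n
oracleOf = mistakeOn

VSet : ℕ → Set
VSet n = Fin n → Bool

exactlyTwo : Bool → Bool → Bool → Bool
exactlyTwo true  true  c = not c
exactlyTwo true  false c = c
exactlyTwo false true  c = c
exactlyTwo false false c = false

-- (u,v,w) is a (+,+,-) triangle within S containing u
IsTri : ∀ {n} → Labelling n → VSet n → Fin n → Fin n → Fin n → Set
IsTri sgn S u v w =
  (S u ≡ true) × (S v ≡ true) × (S w ≡ true) ×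
  (v ≢ u) × (w ≢ u) × (v ≢ w) ×
  (exactlyTwo (sgn u v) (sgn u w) (sgn v w) ≡ true)

occ : ∀ {n} → Fin n → Fin n → List (Fin n × Fin n) → ℕ
occ v w ts = length (filter (λ p → (eqF (proj₁ p) v ∧ eqF (proj₂ p) w)
                                 ∨ (eqF (proj₁ p) w ∧ eqF (proj₂ p) v) Data.Bool.≟ true) ts)
  where import Data.Bool

-- ts is an (arbitrary) enumeration of the set T of (+,+,-) triangles within S
-- containing u: each triangle {u,v,w} is listed exactly once, as (v,w) or (w,v)
-- (the orientation fixes which of the two other vertices the loop treats as v).
EnumT : ∀ {n} → Labelling n → VSet n → Fin n → List (Fin n × Fin n) → Set
EnumT sgn S u ts =
  (∀ {p} → p ∈ ts → IsTri sgn S u (proj₁ p) (proj₂ p)) ×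
  (∀ v w → IsTri sgn S u v w → occ v w ts ≡ 1)

upd : ∀ {n} → (Fin n → Bool) → Fin n → Bool → (Fin n → Bool)
upd f x b y = if eqF y x then b else f y

record LoopState (n : ℕ) : Set where
  constructor st
  field
    queried : Fin n → Bool
    mistake : Fin n → Bool
    count   : ℕ
open LoopState public

loopStep : ∀ {n} → Oracle n → Fin n → LoopState n → Fin n × Fin n → LoopState n
loopStep orc u s (v , w) =
  if mistake s v ∨ mistake s w then s
  else if queried s v ∧ queried s w then s
  else secondQ firstQ
  where
  firstQ : LoopState _
  firstQ = if not (queried s v)
           then st (upd (queried s) v true) (upd (mistake s) v (orc u v)) (suc (count s))
           else s
  secondQ : LoopState _ → LoopState _
  secondQ s1 = if not (queried s1 w) ∧ not (mistake s1 v)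
               then st (upd (queried s1) w true) (upd (mistake s1) w (orc u w)) (suc (count s1))
               else s1

runLoop : ∀ {n} → Oracle n → Fin n → LoopState n → List (Fin n × Fin n) → LoopState n
runLoop orc u s [] = s
runLoop orc u s (t ∷ ts) = runLoop orc u (loopStep orc u s t) ts

initState : ∀ {n} → LoopState n
initState = st (λ _ → false) (λ _ → false) 0

clusterOf : ∀ {n} → Labelling n → VSet n → Fin n → (Fin n → Bool) → VSet n
clusterOf sgn S u M x =
  eqF x u ∨ (S x ∧ not (eqF x u) ∧ (if sgn u x then not (M x) else M x))

removeSet : ∀ {n} → VSet n → VSet n → VSet n
removeSet S C x = S x ∧ not (C x)

-- QPRun sgn orc S q : some execution of QueryPivot(S) (for some choice of
-- pivots and of the order in which triangles are processed) makes q queries.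
data QPRun {n : ℕ} (sgn : Labelling n) (orc : Oracle n) : VSet n → ℕ → Set where
  qp-empty : ∀ {S} → (∀ x → S x ≡ false) → QPRun sgn orc S 0
  qp-step  : ∀ {S} (u : Fin n) → S u ≡ true →
             (ts : List (Fin n × Fin n)) → EnumT sgn S u ts →
             ∀ {q} →
             QPRun sgn orc
               (removeSet S (clusterOf sgn S u (mistake (runLoop orc u initState ts)))) q →
             QPRun sgn orc S (count (runLoop orc u initState ts) + q)

fullSet : ∀ {n} → VSet n
fullSet _ = true

module Submission where

-- Queries are charged to mistakes of OPT. In the round of pivot u, the answer
-- "OPT errs on {u, x}" certifies a mistake, and so do the answers "OPT is correct on
-- {u, v} and on {u, w}" for a (+,+,−) triangle (u, v, w), since no clustering is
-- correct on all three edges of such a triangle. Every iteration of the loop that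
-- queries at all issues at most two queries and certifies a new mistake, so a round
-- makes at most twice as many queries as it certifies mistakes. These lie inside the
-- current vertex set and have an endpoint in the new cluster C, while later rounds
-- work inside the complement of C; so every mistake of OPT is counted at most once.

open import Defs
open import Algebra.Bundles using (CommutativeMonoid)
import Algebra.Properties.CommutativeSemigroup as CommutativeSemigroupProperties
open import Data.Bool using (Bool; true; false; not; _∧_; _∨_; if_then_else_; f≤t; b≤b)
  renaming (_≤_ to _≤ᴮ_)
open import Data.Bool.Properties as Bool using (∧-zeroʳ; ∨-zeroʳ; ∨-comm)
open import Data.Empty using (⊥-elim)
open import Data.Fin using (Fin; toℕ)
open import Data.Fin.Properties using (toℕ-injective) renaming (_≟_ to _≟F_)
open import Data.List using ([]; _∷_; allFin; map)
open import Data.List.Properties using (map-cong)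
open import Data.List.Membership.Propositional using (_∈_)
open import Data.List.Membership.Propositional.Properties using (∈-allFin)
open import Data.List.Relation.Unary.Any using (here; there)
open import Data.Nat using (ℕ; suc; _+_; _*_; _≤_; _<_; _<ᵇ_; _≡ᵇ_; z≤n; s≤s)
open import Data.Nat.ListAction using (sum)
open import Data.Nat.Properties
  using (≤-refl; ≤-trans; ≤-<-trans; +-mono-≤; +-mono-<-≤; +-mono-≤-<; *-suc; *-monoʳ-≤;
         *-distribˡ-+; <-cmp; <⇒<ᵇ; +-commutativeSemigroup; module ≤-Reasoning)
  renaming (_≟_ to _≟ℕ_)
open import Data.Product using (_×_; _,_; proj₁; proj₂)
open import Data.Sum using (_⊎_; inj₁; inj₂)
open import Function using (Equivalence; _∘_)
open import Relation.Binary.Definitions using (tri<; tri≈; tri>)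
open import Relation.Binary.PropositionalEquality
open import Relation.Nullary using (yes; no; proof)
open import Relation.Nullary.Decidable using (isYes≗does; dec-true; dec-false)
open import Relation.Nullary.Reflects using (ofʸ; ofⁿ)

open CommutativeSemigroupProperties +-commutativeSemigroup using (interchange)
open CommutativeMonoid using (commutativeSemigroup)
module ∧ = CommutativeSemigroupProperties (commutativeSemigroup Bool.∧-commutativeMonoid)
module ∨ = CommutativeSemigroupProperties (commutativeSemigroup Bool.∨-commutativeMonoid)

true≢false : true ≢ false
true≢false ()

∧-mono-≤ᴮ : ∀ {a a′ b b′} → a ≤ᴮ a′ → b ≤ᴮ b′ → a ∧ b ≤ᴮ a′ ∧ b′
∧-mono-≤ᴮ {a′ = true} f≤t _    = Bool.≤-minimum _
∧-mono-≤ᴮ {false}     b≤b _    = b≤b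
∧-mono-≤ᴮ {true}      b≤b b≤b′ = b≤b′

∨-mono-≤ᴮ : ∀ {a a′ b b′} → a ≤ᴮ a′ → b ≤ᴮ b′ → a ∨ b ≤ᴮ a′ ∨ b′
∨-mono-≤ᴮ         f≤t _    = Bool.≤-maximum _
∨-mono-≤ᴮ {false} b≤b b≤b′ = b≤b′
∨-mono-≤ᴮ {true}  b≤b _    = b≤b

∨-lub-≤ᴮ : ∀ {a b c} → a ≤ᴮ c → b ≤ᴮ c → a ∨ b ≤ᴮ c
∨-lub-≤ᴮ {false} _   b≤c = b≤c
∨-lub-≤ᴮ {true}  a≤c _   = a≤c

⇒-≤ᴮ : ∀ {a b} → (a ≡ true → b ≡ true) → a ≤ᴮ b
⇒-≤ᴮ {false} _   = Bool.≤-minimum _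
⇒-≤ᴮ {true}  a⇒b rewrite a⇒b refl = b≤b

≤ᴮ-true : ∀ {a b} → a ≤ᴮ b → a ≡ true → b ≡ true
≤ᴮ-true b≤b a≡true = a≡true

∨-introʳ² : ∀ a b {c} → c ≡ true → a ∨ b ∨ c ≡ true
∨-introʳ² true  _     _      = refl
∨-introʳ² false true  _      = refl
∨-introʳ² false false c≡true = c≡true

∧-not≡true : ∀ {a b} → a ∧ not b ≡ true → a ≡ true × b ≡ false
∧-not≡true {true} {false} _ = refl , refl

∧-not-∨-distrib : ∀ a b o c d → (a ∧ b ∧ o) ∧ not (c ∨ d) ≡ (a ∧ not c) ∧ (b ∧ not d) ∧ o
∧-not-∨-distrib false _     _ _     _ = refl
∧-not-∨-distrib true  b     o true  _ = ∧-zeroʳ (b ∧ o)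
∧-not-∨-distrib true  false _ false _ = refl
∧-not-∨-distrib true  true  o false d = Bool.∧-comm o (not d)

⟦_⟧ : Bool → ℕ
⟦ b ⟧ = if b then 1 else 0

⟦⟧-mono : ∀ {a b} → a ≤ᴮ b → ⟦ a ⟧ ≤ ⟦ b ⟧
⟦⟧-mono f≤t = z≤n
⟦⟧-mono b≤b = ≤-refl

⟦∧⟧-split : ∀ a b c → ⟦ a ∧ b ⟧ ≡ ⟦ a ∧ b ∧ c ⟧ + ⟦ a ∧ b ∧ not c ⟧
⟦∧⟧-split false _     _     = refl
⟦∧⟧-split true  false _     = refl
⟦∧⟧-split true  true  false = refl
⟦∧⟧-split true  true  true  = refl

k+c≤2*p′ : ∀ {k c p p′} → k ≤ 2 → c ≤ 2 * p → p < p′ → k + c ≤ 2 * p′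
k+c≤2*p′ {k} {c} {p} {p′} k≤2 c≤2p p<p′ = begin
  k + c      ≤⟨ +-mono-≤ k≤2 c≤2p ⟩
  2 + 2 * p  ≡⟨ *-suc 2 p ⟨
  2 * suc p  ≤⟨ *-monoʳ-≤ 2 p<p′ ⟩
  2 * p′     ∎
  where open ≤-Reasoning

module _ {A : Set} {f g : A → ℕ} where

  sum-map-mono : ∀ xs → (∀ x → f x ≤ g x) → sum (map f xs) ≤ sum (map g xs)
  sum-map-mono []       _   = z≤n
  sum-map-mono (x ∷ xs) f≤g = +-mono-≤ (f≤g x) (sum-map-mono xs f≤g)

  sum-map-< : ∀ {xs x} → (∀ x → f x ≤ g x) → x ∈ xs → f x < g x →
              sum (map f xs) < sum (map g xs)
  sum-map-< {_ ∷ xs} f≤g (here refl)  fx<gx = +-mono-<-≤ fx<gx (sum-map-mono xs f≤g)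
  sum-map-< {y ∷ _}  f≤g (there x∈xs) fx<gx = +-mono-≤-< (f≤g y) (sum-map-< f≤g x∈xs fx<gx)

  sum-map-+ : ∀ xs → sum (map (λ x → f x + g x) xs) ≡ sum (map f xs) + sum (map g xs)
  sum-map-+ []       = refl
  sum-map-+ (x ∷ xs) = begin
    f x + g x + sum (map (λ x → f x + g x) xs)    ≡⟨ cong (f x + g x +_) (sum-map-+ xs) ⟩
    f x + g x + (sum (map f xs) + sum (map g xs))  ≡⟨ interchange (f x) (g x) _ _ ⟩
    f x + sum (map f xs) + (g x + sum (map g xs))  ∎
    where open ≡-Reasoning

-- Counts unordered pairs, each at i < j, so that mistakes sgn cl is
-- #pairs (mistakeOn sgn cl) by definition.
#pairs : ∀ {n} → Labelling n → ℕ
#pairs {n} R =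
  sum (map (λ i → sum (map (λ j → ⟦ (toℕ i <ᵇ toℕ j) ∧ R i j ⟧) (allFin n))) (allFin n))

module _ {n} {R R′ : Labelling n} where

  private
    pointwise : (∀ i j → R i j ≤ᴮ R′ i j) →
                ∀ i j → ⟦ (toℕ i <ᵇ toℕ j) ∧ R i j ⟧ ≤ ⟦ (toℕ i <ᵇ toℕ j) ∧ R′ i j ⟧
    pointwise R≤R′ i j = ⟦⟧-mono (∧-mono-≤ᴮ Bool.≤-refl (R≤R′ i j))

    #pairs-<-ordered : (∀ i j → R i j ≤ᴮ R′ i j) → ∀ {v w} → toℕ v < toℕ w →
                       R v w ≡ false → R′ v w ≡ true → #pairs R < #pairs R′
    #pairs-<-ordered R≤R′ {v} {w} v<w Rvw R′vw =
      sum-map-< (λ i → sum-map-mono (allFin n) (pointwise R≤R′ i)) (∈-allFin v)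
        (sum-map-< (pointwise R≤R′ v) (∈-allFin w) gain)
      where
      gain : ⟦ (toℕ v <ᵇ toℕ w) ∧ R v w ⟧ < ⟦ (toℕ v <ᵇ toℕ w) ∧ R′ v w ⟧
      gain rewrite Equivalence.to Bool.T-≡ (<⇒<ᵇ v<w) | Rvw | R′vw = ≤-refl

  #pairs-mono : (∀ i j → R i j ≤ᴮ R′ i j) → #pairs R ≤ #pairs R′
  #pairs-mono R≤R′ =
    sum-map-mono (allFin n) λ i → sum-map-mono (allFin n) (pointwise R≤R′ i)

  #pairs-cong : (∀ i j → R i j ≡ R′ i j) → #pairs R ≡ #pairs R′
  #pairs-cong R≡R′ = cong sum (map-cong (λ i → cong sum (map-cong (λ j →
    cong (λ b → ⟦ (toℕ i <ᵇ toℕ j) ∧ b ⟧) (R≡R′ i j)) (allFin n))) (allFin n))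

  #pairs-< : SymmetricL R → SymmetricL R′ → (∀ i j → R i j ≤ᴮ R′ i j) →
             ∀ {v w} → v ≢ w → R v w ≡ false → R′ v w ≡ true → #pairs R < #pairs R′
  #pairs-< symR symR′ R≤R′ {v} {w} v≢w Rvw R′vw with <-cmp (toℕ v) (toℕ w)
  ... | tri< v<w _ _ = #pairs-<-ordered R≤R′ v<w Rvw R′vw
  ... | tri≈ _ v≡w _ = ⊥-elim (v≢w (toℕ-injective v≡w))
  ... | tri> _ _ w<v =
    #pairs-<-ordered R≤R′ w<v (trans (symR w v) Rvw) (trans (symR′ w v) R′vw)

#pairs-split : ∀ {n} (R P : Labelling n) →
  #pairs R ≡ #pairs (λ i j → R i j ∧ P i j) + #pairs (λ i j → R i j ∧ not (P i j))
#pairs-split {n} R P = trans (cong sum (map-cong splitRow (allFin n))) (sum-map-+ (allFin n))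
  where
  splitRow : ∀ i → sum (map (λ j → ⟦ (toℕ i <ᵇ toℕ j) ∧ R i j ⟧) (allFin n)) ≡
    sum (map (λ j → ⟦ (toℕ i <ᵇ toℕ j) ∧ R i j ∧ P i j ⟧) (allFin n)) +
    sum (map (λ j → ⟦ (toℕ i <ᵇ toℕ j) ∧ R i j ∧ not (P i j) ⟧) (allFin n))
  splitRow i = trans (cong sum (map-cong (λ j → ⟦∧⟧-split _ (R i j) (P i j)) (allFin n)))
                     (sum-map-+ (allFin n))

-- mistakeOn sgn cl u v is errs (sgn u v) (cl u ≡ᵇ cl v) by definition.
errs : Bool → Bool → Bool
errs s t = if s then not t else t

errs-false : ∀ {s t} → errs s t ≡ false → s ≡ t
errs-false {true}  {true}  _ = refl
errs-false {false} {false} _ = refl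

errs-≢ : ∀ {s t} → s ≢ t → errs s t ≡ true
errs-≢ {true}  {true}  s≢t = ⊥-elim (s≢t refl)
errs-≢ {true}  {false} _   = refl
errs-≢ {false} {true}  _   = refl
errs-≢ {false} {false} s≢t = ⊥-elim (s≢t refl)

≡ᵇ-comm : ∀ a b → (a ≡ᵇ b) ≡ (b ≡ᵇ a)
≡ᵇ-comm 0       0       = refl
≡ᵇ-comm 0       (suc b) = refl
≡ᵇ-comm (suc a) 0       = refl
≡ᵇ-comm (suc a) (suc b) = ≡ᵇ-comm a b

exactlyTwo-≡ᵇ : ∀ a b c → exactlyTwo (a ≡ᵇ b) (a ≡ᵇ c) (b ≡ᵇ c) ≡ false
exactlyTwo-≡ᵇ a b c
  with a ≡ᵇ b | proof (a ≟ℕ b) | a ≡ᵇ c | proof (a ≟ℕ c) | b ≡ᵇ c | proof (b ≟ℕ c)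
... | true  | ofʸ a≡b | true  | ofʸ a≡c | false | ofⁿ b≢c = ⊥-elim (b≢c (trans (sym a≡b) a≡c))
... | true  | ofʸ a≡b | false | ofⁿ a≢c | true  | ofʸ b≡c = ⊥-elim (a≢c (trans a≡b b≡c))
... | false | ofⁿ a≢b | true  | ofʸ a≡c | true  | ofʸ b≡c = ⊥-elim (a≢b (trans a≡c (sym b≡c)))
... | true  | _       | true  | _       | true  | _       = refl
... | true  | _       | false | _       | false | _       = refl
... | false | _       | true  | _       | false | _       = refl
... | false | _       | false | _       | _     | _       = refl

exactlyTwo-comm : ∀ a b c → exactlyTwo a b c ≡ exactlyTwo b a c
exactlyTwo-comm true  true  _ = refl
exactlyTwo-comm true  false _ = refl
exactlyTwo-comm false true  _ = refl
exactlyTwo-comm false false _ = refl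

exactlyTwo⇒∨ : ∀ s₁ s₂ s₃ → exactlyTwo s₁ s₂ s₃ ≡ true → s₁ ∨ s₂ ≡ true
exactlyTwo⇒∨ true  _    _ _ = refl
exactlyTwo⇒∨ false true _ _ = refl

mistakeOn-triangle : ∀ {n} (sgn : Labelling n) (cl : Clustering n) {u v w} →
  exactlyTwo (sgn u v) (sgn u w) (sgn v w) ≡ true →
  mistakeOn sgn cl u v ≡ false → mistakeOn sgn cl u w ≡ false → mistakeOn sgn cl v w ≡ true
mistakeOn-triangle sgn cl {u} {v} {w} signs uv-correct uw-correct =
  errs-≢ {sgn v w} λ vw-correct → true≢false (begin
    true
      ≡⟨ signs ⟨
    exactlyTwo (sgn u v) (sgn u w) (sgn v w)
      ≡⟨ cong₂ (λ a b → exactlyTwo a b (sgn v w)) (errs-false {sgn u v} uv-correct)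
                                                 (errs-false {sgn u w} uw-correct) ⟩
    exactlyTwo (cl u ≡ᵇ cl v) (cl u ≡ᵇ cl w) (sgn v w)
      ≡⟨ cong (exactlyTwo (cl u ≡ᵇ cl v) (cl u ≡ᵇ cl w)) vw-correct ⟩
    exactlyTwo (cl u ≡ᵇ cl v) (cl u ≡ᵇ cl w) (cl v ≡ᵇ cl w)
      ≡⟨ exactlyTwo-≡ᵇ (cl u) (cl v) (cl w) ⟩
    false ∎)
  where open ≡-Reasoning

eqF-refl : ∀ {n} (x : Fin n) → eqF x x ≡ true
eqF-refl x = trans (isYes≗does (x ≟F x)) (dec-true (x ≟F x) refl)

eqF-≢ : ∀ {n} {x y : Fin n} → x ≢ y → eqF x y ≡ false
eqF-≢ {x = x} {y} x≢y = trans (isYes≗does (x ≟F y)) (dec-false (x ≟F y) x≢y)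

eqF-true : ∀ {n} {x y : Fin n} → eqF x y ≡ true → x ≡ y
eqF-true {x = x} {y} e with x ≟F y
... | yes x≡y = x≡y
... | no  _   = ⊥-elim (true≢false (sym e))

upd-≡ : ∀ {n} (f : Fin n → Bool) x b → upd f x b x ≡ b
upd-≡ f x b rewrite eqF-refl x = refl

upd-≢ : ∀ {n} (f : Fin n → Bool) {x} b {y} → y ≢ x → upd f x b y ≡ f y
upd-≢ f b y≢x rewrite eqF-≢ y≢x = refl

module QueryPivotAnalysis {n} (sgn : Labelling n) (sgn-sym : SymmetricL sgn) (opt : Clustering n)
  where

  orc : Oracle n
  orc = oracleOf sgn opt

  orc-sym : SymmetricL orc
  orc-sym x y rewrite sgn-sym x y | ≡ᵇ-comm (opt x) (opt y) = refl

  IsTri-swap : ∀ {S u v w} → IsTri sgn S u v w → IsTri sgn S u w v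
  IsTri-swap {u = u} {v} {w} (Su , Sv , Sw , v≢u , w≢u , v≢w , signs) =
    Su , Sw , Sv , w≢u , v≢u , (λ w≡v → v≢w (sym w≡v)) , signs′
    where
    signs′ : exactlyTwo (sgn u w) (sgn u v) (sgn w v) ≡ true
    signs′ rewrite sgn-sym w v | exactlyTwo-comm (sgn u w) (sgn u v) (sgn v w) = signs

  OptMistakeWithin : VSet n → Labelling n
  OptMistakeWithin S x y = S x ∧ S y ∧ orc x y

  OptMistakeTouching : VSet n → VSet n → Labelling n
  OptMistakeTouching S C x y = OptMistakeWithin S x y ∧ (C x ∨ C y)

  optMistakeWithin-sym : ∀ S → SymmetricL (OptMistakeWithin S)
  optMistakeWithin-sym S x y =
    trans (∧.x∙yz≈y∙xz (S x) (S y) (orc x y)) (cong (λ o → S y ∧ S x ∧ o) (orc-sym x y))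

  optMistakes-split : ∀ S C →
    #pairs (OptMistakeWithin S) ≡
    #pairs (OptMistakeTouching S C) + #pairs (OptMistakeWithin (removeSet S C))
  optMistakes-split S C =
    trans (#pairs-split (OptMistakeWithin S) (λ x y → C x ∨ C y))
          (cong (#pairs (OptMistakeTouching S C) +_)
                (#pairs-cong λ x y → ∧-not-∨-distrib (S x) (S y) (orc x y) (C x) (C y)))

  module Round (S : VSet n) (u : Fin n) where

    -- The sign condition puts a correctly answered endpoint into the cluster of u.
    Charged : Labelling n
    Charged x y = orc x y ∧ (sgn u x ∨ sgn u y)

    charged-sym : SymmetricL Charged
    charged-sym x y = cong₂ _∧_ (orc-sym x y) (∨-comm (sgn u x) (sgn u y))

    triangle-charged : ∀ {v w} → IsTri sgn S u v w → orc u v ≡ false → orc u w ≡ false →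
                       Charged v w ≡ true
    triangle-charged {v} {w} (_ , _ , _ , _ , _ , _ , signs) uv-correct uw-correct
      rewrite mistakeOn-triangle sgn opt signs uv-correct uw-correct
            | exactlyTwo⇒∨ (sgn u v) (sgn u w) (sgn v w) signs = refl

    good : LoopState n → Fin n → Bool
    good s x = queried s x ∧ not (mistake s x)

    good-split : ∀ s x → good s x ≡ true → queried s x ≡ true × mistake s x ≡ false
    good-split s x = ∧-not≡true {queried s x} {mistake s x}

    -- The OPT-mistakes certified by the answers so far; each one pays for two queries.
    Certified : LoopState n → Labelling n
    Certified s x y = (mistake s y ∧ eqF x u) ∨ (mistake s x ∧ eqF y u) ∨
                      (good s x ∧ good s y ∧ Charged x y)

    potential : LoopState n → ℕ
    potential s = #pairs (Certified s)

    certified-sym : ∀ s → SymmetricL (Certified s)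
    certified-sym s x y =
      trans (∨.x∙yz≈y∙xz (mistake s y ∧ eqF x u) (mistake s x ∧ eqF y u) _)
            (cong (λ g → (mistake s x ∧ eqF y u) ∨ (mistake s y ∧ eqF x u) ∨ g) goodPair-sym)
      where
      goodPair-sym : good s x ∧ good s y ∧ Charged x y ≡ good s y ∧ good s x ∧ Charged y x
      goodPair-sym = trans (∧.x∙yz≈y∙xz (good s x) (good s y) (Charged x y))
                           (cong (λ c → good s y ∧ good s x ∧ c) (charged-sym x y))

    certified-mono : ∀ {s s′} → (∀ z → mistake s z ≤ᴮ mistake s′ z) →
                     (∀ z → good s z ≤ᴮ good s′ z) → ∀ x y → Certified s x y ≤ᴮ Certified s′ x y
    certified-mono M≤M′ G≤G′ x y =
      ∨-mono-≤ᴮ (∧-mono-≤ᴮ (M≤M′ y) (Bool.≤-refl {eqF x u}))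
        (∨-mono-≤ᴮ (∧-mono-≤ᴮ (M≤M′ x) (Bool.≤-refl {eqF y u}))
          (∧-mono-≤ᴮ (G≤G′ x) (∧-mono-≤ᴮ (G≤G′ y) (Bool.≤-refl {Charged x y}))))

    record Faithful (s : LoopState n) : Set where
      field
        queried⇒inside     : ∀ {x} → queried s x ≡ true → S x ≡ true
        queried⇒≢pivot     : ∀ {x} → queried s x ≡ true → x ≢ u
        queried⇒answer     : ∀ {x} → queried s x ≡ true → mistake s x ≡ orc u x
        unqueried⇒¬mistake : ∀ {x} → queried s x ≡ false → mistake s x ≡ false

      pivot-unqueried : queried s u ≡ false
      pivot-unqueried with queried s u in q
      ... | true  = ⊥-elim (queried⇒≢pivot q refl)
      ... | false = refl

      mistake⇒queried : ∀ {x} → mistake s x ≡ true → queried s x ≡ true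
      mistake⇒queried {x} m with queried s x in q
      ... | true  = refl
      ... | false = ⊥-elim (true≢false (trans (sym m) (unqueried⇒¬mistake q)))

      good⇒correct : ∀ {x} → good s x ≡ true → orc u x ≡ false
      good⇒correct {x} g = let q , m = good-split s x g in trans (sym (queried⇒answer q)) m

    open Faithful

    query : LoopState n → Fin n → LoopState n
    query s x = st (upd (queried s) x true) (upd (mistake s) x (orc u x)) (suc (count s))

    query-queried : ∀ s x → queried (query s x) x ≡ true
    query-queried s x = upd-≡ (queried s) x true

    query-answer : ∀ s x → mistake (query s x) x ≡ orc u x
    query-answer s x = upd-≡ (mistake s) x (orc u x)

    query-faithful : ∀ {s x} → Faithful s → S x ≡ true → x ≢ u → Faithful (query s x)
    query-faithful {s} {x} F Sx x≢u = record
      { queried⇒inside     = inside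
      ; queried⇒≢pivot     = ≢pivot
      ; queried⇒answer     = answer
      ; unqueried⇒¬mistake = ¬mistake
      }
      where
      inside : ∀ {y} → upd (queried s) x true y ≡ true → S y ≡ true
      inside {y} with y ≟F x
      ... | yes refl = λ _ → Sx
      ... | no _     = queried⇒inside F
      ≢pivot : ∀ {y} → upd (queried s) x true y ≡ true → y ≢ u
      ≢pivot {y} with y ≟F x
      ... | yes refl = λ _ → x≢u
      ... | no _     = queried⇒≢pivot F
      answer : ∀ {y} → upd (queried s) x true y ≡ true → upd (mistake s) x (orc u x) y ≡ orc u y
      answer {y} with y ≟F x
      ... | yes refl = λ _ → refl
      ... | no _     = queried⇒answer F
      ¬mistake : ∀ {y} → upd (queried s) x true y ≡ false → upd (mistake s) x (orc u x) y ≡ false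
      ¬mistake {y} with y ≟F x
      ... | yes refl = λ ()
      ... | no _     = unqueried⇒¬mistake F

    query-mistake-mono : ∀ {s} → Faithful s → ∀ x z → mistake s z ≤ᴮ mistake (query s x) z
    query-mistake-mono {s} F x z with z ≟F x
    ... | no _ = Bool.≤-refl
    ... | yes refl with queried s z in q
    ...   | true  = Bool.≤-reflexive (queried⇒answer F q)
    ...   | false rewrite unqueried⇒¬mistake F q = Bool.≤-minimum _

    query-good-mono : ∀ {s} → Faithful s → ∀ x z → good s z ≤ᴮ good (query s x) z
    query-good-mono {s} F x z with z ≟F x
    ... | no _ = Bool.≤-refl
    ... | yes refl with queried s z in q
    ...   | true  rewrite queried⇒answer F q = Bool.≤-refl
    ...   | false = Bool.≤-minimum _

    query-certified-mono : ∀ {s} → Faithful s → ∀ x a b →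
                           Certified s a b ≤ᴮ Certified (query s x) a b
    query-certified-mono {s} F x =
      certified-mono {s} {query s x} (query-mistake-mono F x) (query-good-mono F x)

    query-potential-mono : ∀ {s} → Faithful s → ∀ x → potential s ≤ potential (query s x)
    query-potential-mono F x = #pairs-mono (query-certified-mono F x)

    query-finds-mistake : ∀ {s x} → Faithful s → queried s x ≡ false → x ≢ u →
                          orc u x ≡ true → potential s < potential (query s x)
    query-finds-mistake {s} {x} F unqueried x≢u ux-wrong =
      #pairs-< (certified-sym s) (certified-sym (query s x)) (query-certified-mono F x)
        (λ u≡x → x≢u (sym u≡x)) before after
      where
      before : Certified s u x ≡ false
      before rewrite unqueried⇒¬mistake F unqueried | unqueried⇒¬mistake F (pivot-unqueried F)
                   | pivot-unqueried F = refl
      after : Certified (query s x) u x ≡ true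
      after rewrite query-answer s x | ux-wrong | eqF-refl u = refl

    query-charges-pair : ∀ {s x y} → Faithful s → queried s x ≡ false → orc u x ≡ false →
                         good s y ≡ true → Charged x y ≡ true → potential s < potential (query s x)
    query-charges-pair {s} {x} {y} F unqueried ux-correct good-y xy-charged =
      #pairs-< (certified-sym s) (certified-sym (query s x)) (query-certified-mono F x)
        x≢y before after
      where
      x≢y : x ≢ y
      x≢y refl = true≢false (trans (sym (proj₁ (good-split s y good-y))) unqueried)
      before : Certified s x y ≡ false
      before rewrite proj₂ (good-split s y good-y) | unqueried⇒¬mistake F unqueried
                   | unqueried = refl
      good-x′ : good (query s x) x ≡ true
      good-x′ = cong₂ (λ a b → a ∧ not b) (query-queried s x)
                                         (trans (query-answer s x) ux-correct)
      after : Certified (query s x) x y ≡ true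
      after = ∨-introʳ² (mistake (query s x) y ∧ eqF x u) (mistake (query s x) x ∧ eqF y u)
        (cong₂ _∧_ good-x′ (cong₂ _∧_ (≤ᴮ-true (query-good-mono F x y) good-y) xy-charged))

    Productive : LoopState n → Fin n → Fin n → Set
    Productive s x y = queried s x ≡ false × (orc u x ≡ true ⊎ good s y ≡ true)

    productive-gain : ∀ {s x y} → Faithful s → IsTri sgn S u x y → Productive s x y →
                      potential s < potential (query s x)
    productive-gain F (_ , _ , _ , x≢u , _) (unqueried , inj₁ ux-wrong) =
      query-finds-mistake F unqueried x≢u ux-wrong
    productive-gain {s} {x} F tri@(_ , _ , _ , x≢u , _) (unqueried , inj₂ good-y) = byAnswer _ refl
      where
      byAnswer : ∀ b → orc u x ≡ b → potential s < potential (query s x)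
      byAnswer true  ux-wrong   = query-finds-mistake F unqueried x≢u ux-wrong
      byAnswer false ux-correct = query-charges-pair F unqueried ux-correct good-y
        (triangle-charged tri ux-correct (good⇒correct F good-y))

    data Transition (s : LoopState n) (v w : Fin n) : LoopState n → Set where
      skip         : Transition s v w s
      query-first  : Productive s v w → Transition s v w (query s v)
      query-second : Productive s w v → Transition s v w (query s w)
      query-both   : Productive (query s v) w v → Transition s v w (query (query s v) w)

    loopStep-transition : ∀ s v w → w ≢ v → Transition s v w (loopStep orc u s (v , w))
    loopStep-transition s v w w≢v with mistake s v in mv | mistake s w in mw | queried s v in qv
    ... | true  | _     | _ = skip
    ... | false | true  | _ = skip
    ... | false | false | true with queried s w in qw
    ...   | true  = skip
    ...   | false rewrite mv = query-second (qw , inj₂ (cong₂ (λ a b → a ∧ not b) qv mv))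
    loopStep-transition s v w w≢v | false | false | false
      with mistake (query s v) v in mv′ | queried (query s v) w in qw′
    ... | true  | true  = query-first (qv , inj₁ (trans (sym (query-answer s v)) mv′))
    ... | true  | false = query-first (qv , inj₁ (trans (sym (query-answer s v)) mv′))
    ... | false | true  = query-first (qv , inj₂ (cong₂ (λ a b → a ∧ not b)
                            (trans (sym (upd-≢ (queried s) true w≢v)) qw′) mw))
    ... | false | false = query-both
                            (qw′ , inj₂ (cong₂ (λ a b → a ∧ not b) (query-queried s v) mv′))

    Invariant : LoopState n → Set
    Invariant s = Faithful s × count s ≤ 2 * potential s

    initial-invariant : Invariant initState
    initial-invariant = record
      { queried⇒inside     = λ ()
      ; queried⇒≢pivot     = λ ()
      ; queried⇒answer     = λ ()
      ; unqueried⇒¬mistake = λ _ → refl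
      } , z≤n

    loopStep-invariant : ∀ {s v w} → Invariant s → IsTri sgn S u v w →
                         Invariant (loopStep orc u s (v , w))
    loopStep-invariant {s} {v} {w} inv@(F , budget) tri@(_ , Sv , Sw , v≢u , w≢u , v≢w , _) =
      byTransition (loopStep-transition s v w (λ w≡v → v≢w (sym w≡v)))
      where
      byTransition : ∀ {s′} → Transition s v w s′ → Invariant s′
      byTransition skip = inv
      byTransition (query-first p) =
        query-faithful F Sv v≢u , k+c≤2*p′ (s≤s z≤n) budget (productive-gain F tri p)
      byTransition (query-second p) =
        query-faithful F Sw w≢u , k+c≤2*p′ (s≤s z≤n) budget (productive-gain F (IsTri-swap tri) p)
      byTransition (query-both p) =
        query-faithful F₁ Sw w≢u ,
        k+c≤2*p′ ≤-refl budget
          (≤-<-trans (query-potential-mono F v) (productive-gain F₁ (IsTri-swap tri) p))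
        where
        F₁ = query-faithful F Sv v≢u

    runLoop-invariant : ∀ ts {s} → Invariant s →
                        (∀ {p} → p ∈ ts → IsTri sgn S u (proj₁ p) (proj₂ p)) →
                        Invariant (runLoop orc u s ts)
    runLoop-invariant []       inv _    = inv
    runLoop-invariant (_ ∷ ts) inv tris =
      runLoop-invariant ts (loopStep-invariant inv (tris (here refl))) (tris ∘ there)

    cluster : LoopState n → VSet n
    cluster s = clusterOf sgn S u (mistake s)

    module _ {s} (F : Faithful s) (Su : S u ≡ true) where

      pivot-in-cluster : cluster s u ≡ true
      pivot-in-cluster rewrite eqF-refl u = refl

      good-in-cluster : ∀ {x} → good s x ≡ true → sgn u x ≡ true → cluster s x ≡ true
      good-in-cluster {x} good-x ux-plus = inCluster (good-split s x good-x)
        where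
        inCluster : queried s x ≡ true × mistake s x ≡ false → cluster s x ≡ true
        inCluster (q , m)
          rewrite eqF-≢ (queried⇒≢pivot F q) | queried⇒inside F q | ux-plus | m = refl

      mistake-within : ∀ {x} → mistake s x ≡ true → OptMistakeWithin S u x ≡ true
      mistake-within {x} m rewrite Su | queried⇒inside F (mistake⇒queried F m) =
        trans (sym (queried⇒answer F (mistake⇒queried F m))) m

      certified⇒touching : ∀ x y → Certified s x y ≤ᴮ OptMistakeTouching S (cluster s) x y
      certified⇒touching x y =
        ∨-lub-≤ᴮ (⇒-≤ᴮ pivotFirst) (∨-lub-≤ᴮ (⇒-≤ᴮ pivotSecond) (⇒-≤ᴮ goodPair))
        where
        C = cluster s
        pivotFirst : mistake s y ∧ eqF x u ≡ true → OptMistakeTouching S C x y ≡ true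
        pivotFirst h with eqF-true {x = x} {u} (Bool.∧-conicalʳ (mistake s y) (eqF x u) h)
        ... | refl = cong₂ _∧_ (mistake-within (Bool.∧-conicalˡ (mistake s y) (eqF x u) h))
                              (cong (_∨ C y) pivot-in-cluster)
        pivotSecond : mistake s x ∧ eqF y u ≡ true → OptMistakeTouching S C x y ≡ true
        pivotSecond h with eqF-true {x = y} {u} (Bool.∧-conicalʳ (mistake s x) (eqF y u) h)
        ... | refl = cong₂ _∧_
          (trans (optMistakeWithin-sym S x u)
                 (mistake-within (Bool.∧-conicalˡ (mistake s x) (eqF u u) h)))
          (trans (cong (C x ∨_) pivot-in-cluster) (∨-zeroʳ (C x)))
        goodPair : good s x ∧ good s y ∧ Charged x y ≡ true → OptMistakeTouching S C x y ≡ true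
        goodPair h = cong₂ _∧_
          (cong₂ _∧_ (inside good-x)
                     (cong₂ _∧_ (inside good-y) (Bool.∧-conicalˡ (orc x y) _ charged)))
          (≤ᴮ-true (∨-mono-≤ᴮ (⇒-≤ᴮ (good-in-cluster good-x)) (⇒-≤ᴮ (good-in-cluster good-y)))
                   (Bool.∧-conicalʳ (orc x y) _ charged))
          where
          good-x  = Bool.∧-conicalˡ (good s x) (good s y ∧ Charged x y) h
          good-y  = Bool.∧-conicalˡ (good s y) (Charged x y) (Bool.∧-conicalʳ (good s x) _ h)
          charged = Bool.∧-conicalʳ (good s y) (Charged x y) (Bool.∧-conicalʳ (good s x) _ h)
          inside : ∀ {z} → good s z ≡ true → S z ≡ true
          inside {z} g = queried⇒inside F (proj₁ (good-split s z g))

      potential≤#touching : potential s ≤ #pairs (OptMistakeTouching S (cluster s))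
      potential≤#touching = #pairs-mono certified⇒touching

  queryPivot-bound : ∀ {S q} → QPRun sgn orc S q → q ≤ 2 * #pairs (OptMistakeWithin S)
  queryPivot-bound (qp-empty _) = z≤n
  queryPivot-bound {S} (qp-step u Su ts (ts-triangles , _) {q} rest) = begin
    count s + q                     ≤⟨ +-mono-≤ (≤-trans budget (*-monoʳ-≤ 2 charged))
                                                (queryPivot-bound rest) ⟩
    2 * touching + 2 * outside      ≡⟨ *-distribˡ-+ 2 touching outside ⟨
    2 * (touching + outside)        ≡⟨ cong (2 *_) (optMistakes-split S (cluster s)) ⟨
    2 * #pairs (OptMistakeWithin S) ∎
    where
    open ≤-Reasoning
    open Round S u
    s = runLoop orc u initState ts
    touching = #pairs (OptMistakeTouching S (cluster s))
    outside  = #pairs (OptMistakeWithin (removeSet S (cluster s)))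
    invariant = runLoop-invariant ts initial-invariant ts-triangles
    budget  = proj₂ invariant
    charged = potential≤#touching (proj₁ invariant) Su

lemma5 : ∀ (n : ℕ) (sgn : Labelling n) → SymmetricL sgn →
         ∀ (opt : Clustering n) → Optimal sgn opt →
         ∀ (q : ℕ) → QPRun sgn (oracleOf sgn opt) fullSet q →
         q ≤ 2 * mistakes sgn opt
lemma5 n sgn sgn-sym opt _ q run = QueryPivotAnalysis.queryPivot-bound sgn sgn-sym opt run
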